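{- Let $(C,\sqsubseteq)$ be a complete lattice with top element $\top$, let $b^*,b_*\colon C\to C$ be monotone maps with $b^*$ left adjoint to $b_*$, and let $i,f\in C$. Let $a\colon C\to C$ be an up-closure operator such that $b^*\circ a\sqsubseteq a\circ b^*$, and assume $a(f)\sqsubseteq f$. Then for every $k\in\mathbb{N}$, \[ a\big((b_*\sqcap f)^k(\top)\big)\sqsubseteq (b_*\sqcap f)^k(\top),\] where $b_*\sqcap f$ denotes the map $x\mapsto b_*(x)\sqcap f$ and $g^0=\mathrm{id}$, $g^{k+1}=g\circ g^k$.
   Context: $b^*$ left adjoint to $b_*$ means $b^*(x)\sqsubseteq y$ iff $x\sqsubseteq b_*(y)$ for all $x,y\in C$. An up-closure operator is a monotone $a\colon C\to C$ with $x\sqsubseteq a(x)$ and $a(a(x))\sqsubseteq a(x)$ for all $x$. Maps are compared pointwise. -}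

module Defs where

open import Level using (Level; _⊔_) renaming (suc to lsuc)
open import Data.Nat using (ℕ; zero; suc)
open import Relation.Binary.Lattice.Bundles using (BoundedLattice)
open import Data.Product using (_×_)

record CompleteLattice c ℓ₁ ℓ₂ : Set (lsuc (c ⊔ ℓ₁ ⊔ ℓ₂)) where
  field
    boundedLattice : BoundedLattice c ℓ₁ ℓ₂
  open BoundedLattice boundedLattice public
  field
    ⋁       : (Carrier → Set c) → Carrier
    ⋁-upper : (S : Carrier → Set c) (x : Carrier) → S x → x ≤ ⋁ S
    ⋁-least : (S : Carrier → Set c) (y : Carrier) →
              ((x : Carrier) → S x → x ≤ y) → ⋁ S ≤ y

module _ {c ℓ₁ ℓ₂} (L : CompleteLattice c ℓ₁ ℓ₂) where
  open CompleteLattice L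

  Monotone : (Carrier → Carrier) → Set (c ⊔ ℓ₂)
  Monotone g = ∀ x y → x ≤ y → g x ≤ g y

  LeftAdjoint : (Carrier → Carrier) → (Carrier → Carrier) → Set (c ⊔ ℓ₂)
  LeftAdjoint l r = ∀ x y → (l x ≤ y → x ≤ r y) × (x ≤ r y → l x ≤ y)


  record IsUpClosure (a : Carrier → Carrier) : Set (c ⊔ ℓ₂) where
    field
      mono       : Monotone a
      extensive  : ∀ x → x ≤ a x
      idempotent : ∀ x → a (a x) ≤ a x

  _⊑ₘ_ : (Carrier → Carrier) → (Carrier → Carrier) → Set (c ⊔ ℓ₂)
  g ⊑ₘ h = ∀ x → g x ≤ h x

iter : ∀ {a} {A : Set a} → (A → A) → ℕ → A → A
iter g zero    x = x
iter g (suc k) x = g (iter g k x)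

module Submission where

-- Call x ∈ C  a-closed  when  a x ≤ x  (a fixpoint of the
-- up-closure a, since a is extensive).  The theorem says every iterate
-- (b⁎ ⊓ f)ᵏ(⊤) is a-closed, and follows by induction on k from three
-- closure properties of the a-closed elements:
--   * ⊤ is a-closed;
--   * a-closed elements are closed under binary meets (a is monotone);
--   * b⁎ preserves a-closedness, because  b* ∘ a ⊑ a ∘ b*  transposes
--     along the adjunction b* ⊣ b⁎: from  b* (a (b⁎ x)) ≤ a (b* (b⁎ x))
--     ≤ a x ≤ x  we get  a (b⁎ x) ≤ b⁎ x.
-- Hence the step map  x ↦ b⁎ x ∧ f  preserves a-closedness whenever f is
-- a-closed, and iterating it from ⊤ stays a-closed.

open import Defs
open import Data.Nat using (ℕ; zero; suc)
open import Function using (_∘_)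
open import Data.Product using (proj₁; proj₂)

module ClosedElements {c ℓ₁ ℓ₂} (L : CompleteLattice c ℓ₁ ℓ₂)
                      (a : CompleteLattice.Carrier L → CompleteLattice.Carrier L)
                      where
  open CompleteLattice L

  Closed : Carrier → Set ℓ₂
  Closed x = a x ≤ x

  ⊤-closed : Closed ⊤
  ⊤-closed = maximum (a ⊤)

  ∧-closed : Monotone L a → ∀ {x y} → Closed x → Closed y → Closed (x ∧ y)
  ∧-closed mono {x} {y} ax≤x ay≤y = ∧-greatest
    (trans (mono (x ∧ y) x (x∧y≤x x y)) ax≤x)
    (trans (mono (x ∧ y) y (x∧y≤y x y)) ay≤y)

  -- A right adjoint b⁎ preserves closed elements when its left adjoint b*
  -- satisfies  b* ∘ a ⊑ a ∘ b*: transpose  b* (a (b⁎ x)) ≤ x.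
  right-adjoint-closed : ∀ {b* b⁎} → Monotone L a → LeftAdjoint L b* b⁎ →
                         _⊑ₘ_ L (b* ∘ a) (a ∘ b*) →
                         ∀ {x} → Closed x → Closed (b⁎ x)
  right-adjoint-closed {b*} {b⁎} mono adj comm {x} ax≤x =
    proj₁ (adj (a (b⁎ x)) x)
      (trans (comm (b⁎ x)) (trans (mono _ _ counit) ax≤x))
    where
    counit : b* (b⁎ x) ≤ x
    counit = proj₂ (adj (b⁎ x) x) refl

  iter-⊤-closed : ∀ {g} → (∀ {x} → Closed x → Closed (g x)) →
                  ∀ k → Closed (iter g k ⊤)
  iter-⊤-closed g-closed zero    = ⊤-closed
  iter-⊤-closed g-closed (suc k) = g-closed (iter-⊤-closed g-closed k)

proposition7p1 : ∀ {c ℓ₁ ℓ₂} (L : CompleteLattice c ℓ₁ ℓ₂) →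
    let open CompleteLattice L in
    (b* b⁎ : Carrier → Carrier) (i f : Carrier) →
    Monotone L b* → Monotone L b⁎ → LeftAdjoint L b* b⁎ →
    (a : Carrier → Carrier) → IsUpClosure L a →
    _⊑ₘ_ L (b* ∘ a) (a ∘ b*) →
    a f ≤ f →
    (k : ℕ) → a (iter (λ x → b⁎ x ∧ f) k ⊤) ≤ iter (λ x → b⁎ x ∧ f) k ⊤
proposition7p1 L b* b⁎ i f _ _ adj a up-closure comm af≤f =
  iter-⊤-closed step-closed
  where
  open CompleteLattice L
  open ClosedElements L a
  open IsUpClosure up-closure using (mono)

  step-closed : ∀ {x} → Closed x → Closed (b⁎ x ∧ f)
  step-closed x-closed =
    ∧-closed mono (right-adjoint-closed mono adj comm x-closed) af≤f
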